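{- Let $f$ be an extended energy function and $f^*=\bigvee_{n\ge0}f^n$ (pointwise). Then for all $x\in L$, $xf^*=x$ if $xf\le x$, and $xf^*=\top$ if $xf>x$. Consequently $f$ is locally $^*$-closed and $f^*$ is an extended energy function.
   Context: Functions are written on the right and composed left to right: $xf$ is $f$ applied to $x$; $f^0=\mathrm{id}$, $f^{n+1}=f^nf$. Let $L=\mathbb{R}_{\ge0}\cup\{\bot,\top\}$ with $\top=\infty$, totally ordered by the usual order and $\bot<x<\top$ for $x\in\mathbb{R}_{\ge0}$; arithmetic is extended by $\bot+z=\bot-z=\bot$, $\top+z=\top-z=\top$ for $z\in\mathbb{R}_{\ge0}$. An extended energy function is a map $f:L\to L$ with $\bot f=\bot$; $\top f=\bot$ if $xf=\bot$ for all $x<\top$ and $\top f=\top$ otherwise; and $yf\ge xf+y-x$ whenever $\bot<x<y<\top$. A map $f:L\to L$ (with $\bot f=\bot$ and $(x\vee y)f=xf\vee yf$) is locally $^*$-closed if for each $x\in L$ either $xf^*=\top$ or there is $N\ge0$ with $xf^*=x\vee xf\vee\dots\vee xf^N$. -}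

module Defs where

open import Level using (0ℓ)
open import Data.Nat using (ℕ; zero; suc)
open import Data.Product using (Σ; ∃; _×_; _,_; proj₁; proj₂)
open import Data.Sum using (_⊎_; inj₁; inj₂)
open import Relation.Nullary using (¬_)
open import Relation.Binary.PropositionalEquality using (_≡_; _≢_; refl; sym; trans; cong; subst)
open import Relation.Binary.Core using (Rel)
open import Relation.Binary.Structures using (IsTotalOrder)
import Algebra.Structures as AS

-- The real numbers, axiomatised as a (Dedekind-)complete ordered field.
-- (agda-stdlib has no real numbers; every model of this record is
-- isomorphic to ℝ.)

IsLubR : {R : Set} → Rel R 0ℓ → (R → Set) → R → Set
IsLubR _≤_ P u = (∀ x → P x → x ≤ u) × (∀ b → (∀ x → P x → x ≤ b) → u ≤ b)

record Reals : Set₁ where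
  infixl 6 _+_
  infixl 7 _*_
  infix 4 _≤_
  field
    R : Set
    _+_ _*_ : R → R → R
    -_ : R → R
    0# 1# : R
    _≤_ : Rel R 0ℓ
    isCommutativeRing : AS.IsCommutativeRing {A = R} _≡_ _+_ _*_ -_ 0# 1#
    0≢1 : 0# ≢ 1#
    inverse : ∀ x → x ≢ 0# → ∃ λ y → x * y ≡ 1#
    isTotalOrder : IsTotalOrder _≡_ _≤_
    +-mono-≤ : ∀ {x y} z → x ≤ y → x + z ≤ y + z
    *-nonneg : ∀ {x y} → 0# ≤ x → 0# ≤ y → 0# ≤ x * y
    complete : (P : R → Set) → ∃ P → (∃ λ b → ∀ x → P x → x ≤ b) →
               ∃ λ u → IsLubR _≤_ P u

  _<_ : R → R → Set
  x < y = (x ≤ y) × (x ≢ y)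

  _-_ : R → R → R
  x - y = x + (- y)

module Over (ℝ : Reals) where
  open Reals ℝ
  open AS.IsCommutativeRing isCommutativeRing using (+-identityˡ; -‿inverseʳ)
  open IsTotalOrder isTotalOrder using (total) renaming (refl to ≤-refl; trans to ≤-trans′)

  ≤-trans : ∀ {x y z} → x ≤ y → y ≤ z → x ≤ z
  ≤-trans = ≤-trans′

  ≤-reflexive : ∀ {x y} → x ≡ y → x ≤ y
  ≤-reflexive refl = ≤-refl

  nonneg-+ : ∀ {a z} → 0# ≤ a → 0# ≤ z → 0# ≤ a + z
  nonneg-+ {a} {z} 0≤a 0≤z =
    ≤-trans 0≤z (≤-trans (≤-reflexive (sym (+-identityˡ z))) (+-mono-≤ z 0≤a))

  nonneg-diff : ∀ {x y} → x ≤ y → 0# ≤ y - x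
  nonneg-diff {x} {y} x≤y =
    ≤-trans (≤-reflexive (sym (-‿inverseʳ x))) (+-mono-≤ (- x) x≤y)

  data L : Set where
    ⊥L  : L
    ⊤L  : L
    fin : (r : R) → .(0# ≤ r) → L

  infix 4 _≤L_ _<L_
  data _≤L_ : L → L → Set where
    ⊥≤    : ∀ {x} → ⊥L ≤L x
    fin≤  : ∀ {r s} .{p : 0# ≤ r} .{q : 0# ≤ s} → r ≤ s → fin r p ≤L fin s q
    fin≤⊤ : ∀ {r} .{p : 0# ≤ r} → fin r p ≤L ⊤L
    ⊤≤⊤   : ⊤L ≤L ⊤L

  _<L_ : L → L → Set
  x <L y = (x ≤L y) × (x ≢ y)

  _∨_ : L → L → L
  ⊥L ∨ y = y
  ⊤L ∨ y = ⊤L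
  fin r p ∨ ⊥L = fin r p
  fin r p ∨ ⊤L = ⊤L
  fin r p ∨ fin s q with total r s
  ... | inj₁ _ = fin s q
  ... | inj₂ _ = fin r p

  addL : L → (z : R) → .(0# ≤ z) → L
  addL ⊥L z _ = ⊥L
  addL ⊤L z _ = ⊤L
  addL (fin a p) z q = fin (a + z) (nonneg-+ p q)

  IsLub : (L → Set) → L → Set
  IsLub P u = (∀ y → P y → y ≤L u) × (∀ v → (∀ y → P y → y ≤L v) → u ≤L v)

  -- iteration, written in the paper's right-action convention:
  -- x f^0 = x, x f^(n+1) = (x f^n) f

  iter : (L → L) → ℕ → L → L
  iter f zero x = x
  iter f (suc n) x = f (iter f n x)

  joinUpTo : (L → L) → ℕ → L → L
  joinUpTo f zero x = x
  joinUpTo f (suc n) x = joinUpTo f n x ∨ iter f (suc n) x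

  IsStar : (L → L) → (L → L) → Set
  IsStar f fstar = ∀ x → IsLub (λ y → ∃ λ n → y ≡ iter f n x) (fstar x)

  record IsEnergy (f : L → L) : Set where
    field
      bot     : f ⊥L ≡ ⊥L
      top-bot : (∀ x → x <L ⊤L → f x ≡ ⊥L) → f ⊤L ≡ ⊥L
      top-top : ¬ (∀ x → x <L ⊤L → f x ≡ ⊥L) → f ⊤L ≡ ⊤L
      energy  : ∀ x y .(px : 0# ≤ x) .(py : 0# ≤ y) → (x<y : x < y) →
                addL (f (fin x px)) (y - x) (nonneg-diff (proj₁ x<y)) ≤L f (fin y py)

  record IsLocallyStarClosed (f fstar : L → L) : Set where
    field
      bot   : f ⊥L ≡ ⊥L
      join  : ∀ x y → f (x ∨ y) ≡ f x ∨ f y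
      local : ∀ x → fstar x ≡ ⊤L ⊎ ∃ λ N → fstar x ≡ joinUpTo f N x

module Submission where

-- Every point x
-- either satisfies x f ≤ x, so the orbit x, x f, x f², … is non-increasing
-- and x f* = x, or x < x f.  In the second case x is finite, x f = x + d
-- with d > 0, and the energy inequality shows that f raises every y ≥ x by
-- at least d; hence x f^n ≥ x + n·d, and by the Archimedean property the
-- orbit has no finite upper bound, so x f* = ⊤.  Local *-closedness and the
-- energy laws for f* are then read off this dichotomy.

open import Level using (0ℓ)
open import Defs
open import Data.Nat using (ℕ; zero; suc)
open import Data.Product using (∃; _×_; _,_; proj₁; proj₂)
open import Data.Sum using (_⊎_; inj₁; inj₂)
open import Data.Empty using (⊥-elim)
open import Relation.Nullary using (¬_; Dec; yes; no)
open import Relation.Binary.PropositionalEquality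
open import Relation.Binary.Structures using (IsTotalOrder)
import Algebra.Structures as AS
open import Algebra.Bundles using (Ring; AbelianGroup)

module Theory (ℝ : Reals) where
  open Reals ℝ
  open Over ℝ
  open AS.IsCommutativeRing isCommutativeRing
    using (isRing; +-isAbelianGroup; +-comm; +-assoc; +-identityˡ; +-identityʳ; -‿inverseʳ)
  open IsTotalOrder isTotalOrder using (total; antisym) renaming (refl to ≤-refl)

  ring : Ring 0ℓ 0ℓ
  ring = record { isRing = isRing }

  +-abelianGroup : AbelianGroup 0ℓ 0ℓ
  +-abelianGroup = record { isAbelianGroup = +-isAbelianGroup }

  open import Algebra.Properties.Ring ring using (-1*x≈-x; -‿involutive; -0#≈0#)
  open import Algebra.Properties.AbelianGroup +-abelianGroup
    using (//-rightDividesˡ; //-rightDividesʳ; x∙y⁻¹≈ε⇒x≈y; x≈y⇒x∙y⁻¹≈ε; ∙-cancelʳ)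

  sub-add : ∀ x y → x + (y - x) ≡ y
  sub-add x y = trans (+-comm x (y - x)) (//-rightDividesˡ x y)

  add-sub : ∀ s d → (s + d) - d ≡ s
  add-sub s d = //-rightDividesʳ d s

  swap-shift : ∀ a x y → a + (y - x) ≡ y + (a - x)
  swap-shift a x y = begin
    a + (y + - x)   ≡⟨ +-assoc a y (- x) ⟨
    (a + y) + - x   ≡⟨ cong (_+ - x) (+-comm a y) ⟩
    (y + a) + - x   ≡⟨ +-assoc y a (- x) ⟩
    y + (a + - x)   ∎
    where open ≡-Reasoning

  -- 1 is positive: otherwise 0 ≤ -1 and 1 = (-1)(-1) ≥ 0 anyway.
  0≤1 : 0# ≤ 1#
  0≤1 with total 0# 1#
  ... | inj₁ 0≤1 = 0≤1
  ... | inj₂ 1≤0 = subst (0# ≤_) (trans (-1*x≈-x (- 1#)) (-‿involutive 1#)) (*-nonneg 0≤-1 0≤-1)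
    where
    0≤-1 : 0# ≤ - 1#
    0≤-1 = subst₂ _≤_ (-‿inverseʳ 1#) (+-identityˡ (- 1#)) (+-mono-≤ (- 1#) 1≤0)

  1≰0 : ¬ (1# ≤ 0#)
  1≰0 1≤0 = 0≢1 (antisym 0≤1 1≤0)

  ≤-minus⇒nonpos : ∀ s d → s ≤ s - d → d ≤ 0#
  ≤-minus⇒nonpos s d s≤s-d =
    subst₂ _≤_ (trans (cong (_- s) (+-comm s d)) (add-sub d s)) (-‿inverseʳ s)
      (+-mono-≤ (- s) (subst (s + d ≤_) (//-rightDividesˡ d s) (+-mono-≤ d s≤s-d)))

  _·_ : ℕ → R → R
  zero  · d = 0#
  suc n · d = n · d + d

  ·-nonneg : ∀ {d} n → 0# ≤ d → 0# ≤ n · d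
  ·-nonneg zero    0≤d = ≤-refl
  ·-nonneg (suc n) 0≤d = nonneg-+ (·-nonneg n 0≤d) 0≤d

  ·-zeroʳ : ∀ n → n · 0# ≡ 0#
  ·-zeroʳ zero    = refl
  ·-zeroʳ (suc n) = trans (+-identityʳ (n · 0#)) (·-zeroʳ n)

  -- If all multiples of d are bounded then d ≤ 0: the supremum s of the
  -- multiples satisfies s ≤ s - d, since n·d + d is again a multiple.
  archimedean : ∀ d b → (∀ n → n · d ≤ b) → d ≤ 0#
  archimedean d b bounded = ≤-minus⇒nonpos s d (least (s - d) below)
    where
    Multiple : R → Set
    Multiple t = ∃ λ n → t ≡ n · d
    sup : ∃ λ s → IsLubR _≤_ Multiple s
    sup = complete Multiple (0# , zero , refl) (b , λ { _ (n , refl) → bounded n })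
    s : R
    s = proj₁ sup
    upper : ∀ t → Multiple t → t ≤ s
    upper = proj₁ (proj₂ sup)
    least : ∀ c → (∀ t → Multiple t → t ≤ c) → s ≤ c
    least = proj₂ (proj₂ sup)
    below : ∀ t → Multiple t → t ≤ s - d
    below _ (n , refl) =
      subst (_≤ s - d) (add-sub (n · d) d) (+-mono-≤ (- d) (upper _ (suc n , refl)))

  -- Equality of reals is ¬¬-stable; for 0 ≤ d, ¬¬(d ≡ 0) bounds all n·d by 1.
  nonneg-stable : ∀ d → 0# ≤ d → ¬ ¬ (d ≡ 0#) → d ≡ 0#
  nonneg-stable d 0≤d ¬¬d≡0 = antisym (archimedean d 1# bounded) 0≤d
    where
    bounded : ∀ n → n · d ≤ 1#
    bounded n with total (n · d) 1#
    ... | inj₁ nd≤1 = nd≤1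
    ... | inj₂ 1≤nd = ⊥-elim (¬¬d≡0 λ d≡0 →
      1≰0 (subst (1# ≤_) (trans (cong (n ·_) d≡0) (·-zeroʳ n)) 1≤nd))

  ≡-stable : ∀ a b → ¬ ¬ (a ≡ b) → a ≡ b
  ≡-stable a b ¬¬a≡b with total a b
  ... | inj₁ a≤b = sym (x∙y⁻¹≈ε⇒x≈y b a (nonneg-stable (b - a) (nonneg-diff a≤b)
                     λ k → ¬¬a≡b λ a≡b → k (x≈y⇒x∙y⁻¹≈ε (sym a≡b))))
  ... | inj₂ b≤a = x∙y⁻¹≈ε⇒x≈y a b (nonneg-stable (a - b) (nonneg-diff b≤a)
                     λ k → ¬¬a≡b λ a≡b → k (x≈y⇒x∙y⁻¹≈ε a≡b))

  -- Weak excluded middle: u = sup ({0} ∪ {1 | Q}) is 1 if Q and 0 if ¬Q,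
  -- so comparing u with 1 - u refutes one of the two.
  weak-lem : (Q : Set) → ¬ Q ⊎ ¬ ¬ Q
  weak-lem Q = refute (total u (1# - u))
    where
    Point : R → Set
    Point t = (t ≡ 0#) ⊎ ((t ≡ 1#) × Q)
    ≤1 : ∀ t → Point t → t ≤ 1#
    ≤1 _ (inj₁ refl) = 0≤1
    ≤1 _ (inj₂ (refl , _)) = ≤-refl
    sup : ∃ λ u → IsLubR _≤_ Point u
    sup = complete Point (0# , inj₁ refl) (1# , ≤1)
    u : R
    u = proj₁ sup
    upper : ∀ t → Point t → t ≤ u
    upper = proj₁ (proj₂ sup)
    least : ∀ c → (∀ t → Point t → t ≤ c) → u ≤ c
    least = proj₂ (proj₂ sup)
    u≡1 : Q → u ≡ 1#
    u≡1 q = antisym (least 1# ≤1) (upper 1# (inj₂ (refl , q)))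
    u≡0 : ¬ Q → u ≡ 0#
    u≡0 ¬q = antisym (least 0# ≤0) (upper 0# (inj₁ refl))
      where
      ≤0 : ∀ t → Point t → t ≤ 0#
      ≤0 _ (inj₁ refl) = ≤-refl
      ≤0 _ (inj₂ (_ , q)) = ⊥-elim (¬q q)
    1-0≡1 : 1# - 0# ≡ 1#
    1-0≡1 = trans (cong (1# +_) -0#≈0#) (+-identityʳ 1#)
    refute : (u ≤ 1# - u) ⊎ (1# - u ≤ u) → ¬ Q ⊎ ¬ ¬ Q
    refute (inj₁ u≤1-u) = inj₁ λ q →
      1≰0 (subst₂ _≤_ (u≡1 q) (trans (cong (λ t → 1# - t) (u≡1 q)) (-‿inverseʳ 1#)) u≤1-u)
    refute (inj₂ 1-u≤u) = inj₂ λ ¬q →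
      1≰0 (subst₂ _≤_ (trans (cong (λ t → 1# - t) (u≡0 ¬q)) 1-0≡1) (u≡0 ¬q) 1-u≤u)

  _≟_ : ∀ a b → Dec (a ≡ b)
  a ≟ b with weak-lem (a ≡ b)
  ... | inj₁ a≢b  = no a≢b
  ... | inj₂ ¬¬a≡b = yes (≡-stable a b ¬¬a≡b)

  fin-≡ : ∀ {r s} .{p : 0# ≤ r} .{q : 0# ≤ s} → r ≡ s → fin r p ≡ fin s q
  fin-≡ refl = refl

  fin-injective : ∀ {r s} .{p : 0# ≤ r} .{q : 0# ≤ s} → fin r p ≡ fin s q → r ≡ s
  fin-injective refl = refl

  fin≤-inv : ∀ {r s} .{p : 0# ≤ r} .{q : 0# ≤ s} → fin r p ≤L fin s q → r ≤ s
  fin≤-inv (fin≤ r≤s) = r≤s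

  ≤L-refl : ∀ x → x ≤L x
  ≤L-refl ⊥L        = ⊥≤
  ≤L-refl ⊤L        = ⊤≤⊤
  ≤L-refl (fin r p) = fin≤ ≤-refl

  ≤L-reflexive : ∀ {x y} → x ≡ y → x ≤L y
  ≤L-reflexive {x} refl = ≤L-refl x

  ≤L-trans : ∀ {x y z} → x ≤L y → y ≤L z → x ≤L z
  ≤L-trans ⊥≤         _          = ⊥≤
  ≤L-trans (fin≤ x≤y) (fin≤ y≤z) = fin≤ (≤-trans x≤y y≤z)
  ≤L-trans (fin≤ _)   fin≤⊤      = fin≤⊤
  ≤L-trans fin≤⊤      ⊤≤⊤        = fin≤⊤
  ≤L-trans ⊤≤⊤        ⊤≤⊤        = ⊤≤⊤

  ≤L-antisym : ∀ {x y} → x ≤L y → y ≤L x → x ≡ y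
  ≤L-antisym ⊥≤         ⊥≤         = refl
  ≤L-antisym (fin≤ x≤y) (fin≤ y≤x) = fin-≡ (antisym x≤y y≤x)
  ≤L-antisym ⊤≤⊤        ⊤≤⊤        = refl

  ≤⊤L : ∀ x → x ≤L ⊤L
  ≤⊤L ⊥L        = ⊥≤
  ≤⊤L ⊤L        = ⊤≤⊤
  ≤⊤L (fin r p) = fin≤⊤

  ⊤≤⇒≡⊤ : ∀ {x} → ⊤L ≤L x → x ≡ ⊤L
  ⊤≤⇒≡⊤ ⊤≤⊤ = refl

  <-≤-trans : ∀ {x y z} → x <L y → y ≤L z → x <L z
  <-≤-trans (x≤y , x≢y) y≤z =
    ≤L-trans x≤y y≤z , λ x≡z → x≢y (≤L-antisym x≤y (subst (_ ≤L_) (sym x≡z) y≤z))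

  -- L is a decidable total order: each pair is ordered one way or strictly
  -- the other (this is where decidable equality of reals is needed).
  compare : ∀ x y → y ≤L x ⊎ x <L y
  compare x         ⊥L        = inj₁ ⊥≤
  compare ⊥L        ⊤L        = inj₂ (⊥≤ , λ ())
  compare ⊤L        ⊤L        = inj₁ ⊤≤⊤
  compare (fin r p) ⊤L        = inj₂ (fin≤⊤ , λ ())
  compare ⊥L        (fin s q) = inj₂ (⊥≤ , λ ())
  compare ⊤L        (fin s q) = inj₁ fin≤⊤
  compare (fin r p) (fin s q) with total r s
  ... | inj₂ s≤r = inj₁ (fin≤ s≤r)
  ... | inj₁ r≤s with r ≟ s
  ...   | yes r≡s = inj₁ (fin≤ (≤-reflexive (sym r≡s)))
  ...   | no  r≢s = inj₂ (fin≤ r≤s , λ e → r≢s (fin-injective e))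

  x≤y⇒x∨y≡y : ∀ {x y} → x ≤L y → x ∨ y ≡ y
  x≤y⇒x∨y≡y ⊥≤    = refl
  x≤y⇒x∨y≡y ⊤≤⊤   = refl
  x≤y⇒x∨y≡y fin≤⊤ = refl
  x≤y⇒x∨y≡y {fin r _} {fin s _} (fin≤ r≤s) with total r s
  ... | inj₁ _   = refl
  ... | inj₂ s≤r = fin-≡ (antisym r≤s s≤r)

  y≤x⇒x∨y≡x : ∀ {x y} → y ≤L x → x ∨ y ≡ x
  y≤x⇒x∨y≡x {⊥L}      ⊥≤ = refl
  y≤x⇒x∨y≡x {⊤L}      _  = refl
  y≤x⇒x∨y≡x {fin r p} ⊥≤ = refl
  y≤x⇒x∨y≡x {fin r _} {fin s _} (fin≤ s≤r) with total r s
  ... | inj₁ r≤s = fin-≡ (antisym s≤r r≤s)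
  ... | inj₂ _   = refl

  ≤addL : ∀ x d .(pd : 0# ≤ d) → 0# ≤ d → x ≤L addL x d pd
  ≤addL ⊥L        d _ _   = ⊥≤
  ≤addL ⊤L        d _ _   = ⊤≤⊤
  ≤addL (fin r p) d _ 0≤d =
    fin≤ (subst₂ _≤_ (+-identityˡ r) (+-comm d r) (+-mono-≤ r 0≤d))

  addL-mono : ∀ {x y} d .(pd : 0# ≤ d) → x ≤L y → addL x d pd ≤L addL y d pd
  addL-mono d _ ⊥≤         = ⊥≤
  addL-mono d _ (fin≤ r≤s) = fin≤ (+-mono-≤ d r≤s)
  addL-mono d _ fin≤⊤      = fin≤⊤
  addL-mono d _ ⊤≤⊤        = ⊤≤⊤

  addL-injective : ∀ {x y} d .(pd : 0# ≤ d) → addL x d pd ≡ addL y d pd → x ≡ y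
  addL-injective {⊥L}      {⊥L}      d _ _ = refl
  addL-injective {⊤L}      {⊤L}      d _ _ = refl
  addL-injective {fin r _} {fin s _} d _ e = fin-≡ (∙-cancelʳ d r s (fin-injective e))
  addL-injective {⊥L}      {⊤L}      d _ ()
  addL-injective {⊥L}      {fin _ _} d _ ()
  addL-injective {⊤L}      {⊥L}      d _ ()
  addL-injective {⊤L}      {fin _ _} d _ ()
  addL-injective {fin _ _} {⊥L}      d _ ()
  addL-injective {fin _ _} {⊤L}      d _ ()

  addL-strict : ∀ {x y} d .(pd : 0# ≤ d) → x <L y → addL x d pd <L addL y d pd
  addL-strict d pd (x≤y , x≢y) = addL-mono d pd x≤y , λ e → x≢y (addL-injective d pd e)

  module Energy (f : L → L) (isEnergy : IsEnergy f) where
    open IsEnergy isEnergy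

    f⊤≡⊤ : ∀ {x} → x <L ⊤L → f x ≢ ⊥L → f ⊤L ≡ ⊤L
    f⊤≡⊤ {x} x<⊤ fx≢⊥ = top-top λ allBot → fx≢⊥ (allBot x x<⊤)

    ≡⊥⊎≢⊥ : ∀ x → x ≡ ⊥L ⊎ x ≢ ⊥L
    ≡⊥⊎≢⊥ ⊥L        = inj₁ refl
    ≡⊥⊎≢⊥ ⊤L        = inj₂ λ ()
    ≡⊥⊎≢⊥ (fin r p) = inj₂ λ ()

    -- the energy inequality with d = y - x ≥ 0 makes f monotone
    mono : ∀ {x y} → x ≤L y → f x ≤L f y
    mono {⊥L} {y} ⊥≤ = subst (_≤L f y) (sym bot) ⊥≤
    mono ⊤≤⊤ = ≤L-refl (f ⊤L)
    mono (fin≤⊤ {r} {p}) with ≡⊥⊎≢⊥ (f (fin r p))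
    ... | inj₁ fx≡⊥ = subst (_≤L f ⊤L) (sym fx≡⊥) ⊥≤
    ... | inj₂ fx≢⊥ = subst (f (fin r p) ≤L_) (sym (f⊤≡⊤ (fin≤⊤ , λ ()) fx≢⊥)) (≤⊤L _)
    mono (fin≤ {r} {s} {p} {q} r≤s) with r ≟ s
    ... | yes refl = ≤L-refl _
    ... | no  r≢s  = ≤L-trans (≤addL (f (fin r p)) (s - r) _ (nonneg-diff r≤s))
                              (energy r s p q (r≤s , r≢s))

    -- a monotone map on a total order preserves binary joins
    preserves-∨ : ∀ x y → f (x ∨ y) ≡ f x ∨ f y
    preserves-∨ x y with compare x y
    ... | inj₁ y≤x       = trans (cong f (y≤x⇒x∨y≡x y≤x)) (sym (y≤x⇒x∨y≡x (mono y≤x)))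
    ... | inj₂ (x≤y , _) = trans (cong f (x≤y⇒x∨y≡y x≤y)) (sym (x≤y⇒x∨y≡y (mono x≤y)))

    -- If f raises the finite point r to a, it raises every y ≥ r by at
    -- least a - r: y f ≥ r f + (y - r) = y + (a - r).
    raise : ∀ {r a} .{p : 0# ≤ r} .{q : 0# ≤ a} → f (fin r p) ≡ fin a q →
            (r≤a : r ≤ a) → ∀ {y} → fin r p ≤L y →
            addL y (a - r) (nonneg-diff r≤a) ≤L f y
    raise {r} {a} fr≡a r≤a (fin≤ {s = s} {q = q} r≤s) with r ≟ s
    ... | yes refl = ≤L-reflexive (trans (fin-≡ (sub-add r a)) (sym fr≡a))
    ... | no  r≢s  = ≤L-trans (≤L-reflexive (fin-≡ (sym (swap-shift a r s))))
                       (subst (λ v → addL v (s - r) (nonneg-diff r≤s) ≤L f (fin s q)) fr≡a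
                          (energy r s _ q (r≤s , r≢s)))
    raise fr≡a r≤a fin≤⊤ =
      ≤L-reflexive (sym (f⊤≡⊤ (fin≤⊤ , λ ()) λ fr≡⊥ → fin≢⊥ (trans (sym fr≡a) fr≡⊥)))
      where
      fin≢⊥ : ∀ {a} .{q : 0# ≤ a} → fin a q ≢ ⊥L
      fin≢⊥ ()

    -- Hence the orbit of r climbs by steps of d = a - r: r f^n ≥ r + n·d.
    -- If it stays below a finite bound, the Archimedean property gives d = 0.
    bounded-orbit : ∀ {r a u} .{p : 0# ≤ r} .{q : 0# ≤ a} .{w : 0# ≤ u} →
                    f (fin r p) ≡ fin a q → r ≤ a →
                    (∀ n → iter f n (fin r p) ≤L fin u w) → a ≡ r
    bounded-orbit {r} {a} {u} {p} fr≡a r≤a bounded =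
      x∙y⁻¹≈ε⇒x≈y a r (antisym (archimedean d (u - r) steps-bounded) 0≤d)
      where
      d : R
      d = a - r
      0≤d : 0# ≤ d
      0≤d = nonneg-diff r≤a
      climb : ∀ n → fin (r + n · d) (nonneg-+ p (·-nonneg n 0≤d)) ≤L iter f n (fin r p)
      climb zero = ≤L-reflexive (fin-≡ (+-identityʳ r))
      climb (suc n) =
        ≤L-trans (≤L-reflexive (fin-≡ (sym (+-assoc r (n · d) d))))
          (≤L-trans (addL-mono d 0≤d (climb n))
            (raise fr≡a r≤a (≤L-trans r≤r+nd (climb n))))
        where
        r≤r+nd : fin r p ≤L addL (fin r p) (n · d) (·-nonneg n 0≤d)
        r≤r+nd = ≤addL (fin r p) (n · d) (·-nonneg n 0≤d) (·-nonneg n 0≤d)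
      steps-bounded : ∀ n → n · d ≤ u - r
      steps-bounded n =
        subst (_≤ u - r) (trans (cong (_- r) (+-comm r (n · d))) (add-sub (n · d) r))
          (+-mono-≤ (- r) (fin≤-inv (≤L-trans (climb n) (bounded n))))

    -- Escaping points propagate upwards: x < x f and x < y give
    -- y = x + (y - x) < x f + (y - x) ≤ y f.
    escape-up : ∀ x y .(px : 0# ≤ x) .(py : 0# ≤ y) → x < y →
                fin x px <L f (fin x px) → fin y py <L f (fin y py)
    escape-up x y px py x<y x<fx =
      subst (_<L f (fin y py)) (fin-≡ (sub-add x y))
        (<-≤-trans (addL-strict (y - x) _ x<fx) (energy x y px py x<y))

    module Star (fstar : L → L) (isStar : IsStar f fstar) where

      orbit≤star : ∀ x n → iter f n x ≤L fstar x
      orbit≤star x n = proj₁ (isStar x) _ (n , refl)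

      star-least : ∀ x v → (∀ n → iter f n x ≤L v) → fstar x ≤L v
      star-least x v orbit≤v = proj₂ (isStar x) v λ { _ (n , refl) → orbit≤v n }

      -- if x f ≤ x the orbit never rises above x
      star-fixed : ∀ x → f x ≤L x → fstar x ≡ x
      star-fixed x fx≤x = ≤L-antisym (star-least x x orbit≤x) (orbit≤star x 0)
        where
        orbit≤x : ∀ n → iter f n x ≤L x
        orbit≤x zero    = ≤L-refl x
        orbit≤x (suc n) = ≤L-trans (mono (orbit≤x n)) fx≤x

      -- if x < x f the orbit has no finite bound; ⊥ and ⊤ cannot escape
      star-escape : ∀ x → x <L f x → fstar x ≡ ⊤L
      star-escape ⊥L (_ , ⊥≢f⊥) = ⊥-elim (⊥≢f⊥ (sym bot))
      star-escape ⊤L (⊤≤f⊤ , ⊤≢f⊤) = ⊥-elim (⊤≢f⊤ (sym (⊤≤⇒≡⊤ ⊤≤f⊤)))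
      star-escape (fin r p) x<fx with f (fin r p) in fr≡ | fstar (fin r p) in star≡
      ... | ⊥L      | _ with () ← proj₁ x<fx
      ... | ⊤L      | _ = ⊤≤⇒≡⊤ (subst₂ _≤L_ fr≡ star≡ (orbit≤star _ 1))
      ... | fin a q | ⊤L = refl
      ... | fin a q | ⊥L with () ← subst (fin r p ≤L_) star≡ (orbit≤star _ 0)
      ... | fin a q | fin u w =
        ⊥-elim (proj₂ x<fx (fin-≡ (sym (bounded-orbit fr≡ (fin≤-inv (proj₁ x<fx)) bounded))))
        where
        bounded : ∀ n → iter f n (fin r p) ≤L fin u w
        bounded n = subst (_ ≤L_) star≡ (orbit≤star _ n)

      star-locallyClosed : IsLocallyStarClosed f fstar
      star-locallyClosed = record { bot = bot ; join = preserves-∨ ; local = local }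
        where
        local : ∀ x → fstar x ≡ ⊤L ⊎ ∃ λ N → fstar x ≡ joinUpTo f N x
        local x with compare x (f x)
        ... | inj₁ fx≤x = inj₂ (0 , star-fixed x fx≤x)
        ... | inj₂ x<fx = inj₁ (star-escape x x<fx)

      star-energy : IsEnergy fstar
      star-energy = record
        { bot     = star-fixed ⊥L (≤L-reflexive bot)
        ; top-bot = λ allBot →
            ⊥-elim (0≰⊥ (subst (fin 0# ≤-refl ≤L_) (allBot _ (fin≤⊤ , λ ())) (orbit≤star _ 0)))
        ; top-top = λ _ → ⊤≤⇒≡⊤ (orbit≤star ⊤L 0)
        ; energy  = star-raise
        }
        where
        -- f* x ≥ x, so no finite point is sent to ⊥ and ⊤ f* = ⊤
        0≰⊥ : ¬ (fin 0# ≤-refl ≤L ⊥L)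
        0≰⊥ ()
        -- a fixed x gives x f* + (y - x) = y ≤ y f*; an escaping x forces y to escape
        star-raise : ∀ x y .(px : 0# ≤ x) .(py : 0# ≤ y) → (x<y : x < y) →
                     addL (fstar (fin x px)) (y - x) (nonneg-diff (proj₁ x<y)) ≤L fstar (fin y py)
        star-raise x y px py x<y with compare (fin x px) (f (fin x px))
        ... | inj₁ fx≤x rewrite star-fixed _ fx≤x =
          ≤L-trans (≤L-reflexive (fin-≡ (sub-add x y))) (orbit≤star _ 0)
        ... | inj₂ x<fx rewrite star-escape _ x<fx | star-escape _ (escape-up x y px py x<y x<fx) =
          ⊤≤⊤

mainTheorem17 : (ℝ : Reals) → let open Over ℝ in
    (f : L → L) → IsEnergy f →
    (fstar : L → L) → IsStar f fstar →
    (∀ x → (f x ≤L x → fstar x ≡ x) × (x <L f x → fstar x ≡ ⊤L))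
    × IsLocallyStarClosed f fstar
    × IsEnergy fstar
mainTheorem17 ℝ f isEnergy fstar isStar =
  (λ x → star-fixed x , star-escape x) , star-locallyClosed , star-energy
  where
  open Theory ℝ
  open Energy f isEnergy
  open Star fstar isStar
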